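{- Let $p$ be a prime, $n\ge 2$ an integer, and let $H\le\mathrm{GL}_2(\mathbb{Z}/p^n\mathbb{Z})$ have $1$-uppertriangular tendencies. Let $\pi:\mathrm{GL}_2(\mathbb{Z}/p^n\mathbb{Z})\to\mathrm{GL}_2(\mathbb{Z}/p\mathbb{Z})$ be the reduction map. If $H$ is not uppertriangular mod $p$, then $|H|\le p^{2n-2}|\pi(H)|$. Furthermore, if $H$ contains a matrix whose trace and bottom-left entry are both nonzero mod $p$, then $|H|\le p^{n-1}|\pi(H)|$.
   Context: For a prime $\ell$ and integers $0\le m<n$, a subgroup $H\le\mathrm{GL}_2(\mathbb{Z}/\ell^n\mathbb{Z})$ has $m$-uppertriangular tendencies if for every $\begin{pmatrix} a&b\\ c&d\end{pmatrix}\in H$, $c\equiv 0\pmod{\ell^m}$ implies $c\equiv 0\pmod{\ell^n}$. $H$ is uppertriangular mod $p$ if every $\begin{pmatrix} a&b\\ c&d\end{pmatrix}\in H$ has $c\equiv 0\pmod p$. -}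

module Defs where

open import Data.Nat using (ℕ; zero; suc; _+_; _*_; _^_; NonZero)
open import Data.Nat.Properties using (m^n≢0)
open import Data.Nat.Primality using (Prime; prime⇒nonZero)
open import Data.Nat.DivMod using (_mod_)
open import Data.Nat.Divisibility using (_∣_)
open import Data.Fin using (Fin; toℕ)
open import Data.Fin.Properties using () renaming (_≟_ to _≟ᶠ_)
open import Data.Bool using (Bool; true; false; T; _∧_)
open import Data.List using (List; []; _∷_; concatMap; length; filterᵇ)
open import Data.Bool.ListAction using (any)
open import Data.List using () renaming (allFin to allFinL)
open import Data.Product using (Σ; _×_; ∃)
open import Relation.Binary.PropositionalEquality using (_≡_)
open import Relation.Nullary using (¬_)
open import Relation.Nullary.Decidable using (⌊_⌋)

-- 2x2 matrices over ℤ/Nℤ, entries are canonical representatives Fin N.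
record Mat (N : ℕ) : Set where
  constructor mat
  field
    a b c d : Fin N
open Mat public

-- reduction of a natural number into ℤ/Nℤ; an element of Fin N witnesses N ≠ 0
red : ∀ {N} → Fin N → ℕ → Fin N
red {suc k} _ m = m mod (suc k)

_⊕_ : ∀ {N} → Fin N → Fin N → Fin N
x ⊕ y = red x (toℕ x + toℕ y)

_⊗_ : ∀ {N} → Fin N → Fin N → Fin N
x ⊗ y = red x (toℕ x * toℕ y)

mul : ∀ {N} → Mat N → Mat N → Mat N
mul (mat a₁ b₁ c₁ d₁) (mat a₂ b₂ c₂ d₂) =
  mat ((a₁ ⊗ a₂) ⊕ (b₁ ⊗ c₂)) ((a₁ ⊗ b₂) ⊕ (b₁ ⊗ d₂))
      ((c₁ ⊗ a₂) ⊕ (d₁ ⊗ c₂)) ((c₁ ⊗ b₂) ⊕ (d₁ ⊗ d₂))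

I : ∀ N .{{_ : NonZero N}} → Mat N
I N = mat (1 mod N) (0 mod N) (0 mod N) (1 mod N)

tr : ∀ {N} → Mat N → Fin N
tr A = a A ⊕ d A

Subset₂ : ℕ → Set
Subset₂ N = Mat N → Bool

IsGL : ∀ N .{{_ : NonZero N}} → Mat N → Set
IsGL N A = Σ (Mat N) λ B → (mul A B ≡ I N) × (mul B A ≡ I N)

IsSubgroupGL : ∀ N .{{_ : NonZero N}} → Subset₂ N → Set
IsSubgroupGL N H =
  (∀ g → T (H g) → IsGL N g)
  × T (H (I N))
  × (∀ g h → T (H g) → T (H h) → T (H (mul g h)))
  × (∀ g → T (H g) → Σ (Mat N) λ h → T (H h) × (mul g h ≡ I N) × (mul h g ≡ I N))

IsSubgroupGLpn : (p n : ℕ) → Prime p → Subset₂ (p ^ n) → Set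
IsSubgroupGLpn p n pp H = IsSubgroupGL (p ^ n) {{m^n≢0 p n {{prime⇒nonZero pp}}}} H

allMats : ∀ N → List (Mat N)
allMats N = concatMap (λ x → concatMap (λ y → concatMap (λ z → concatMap (λ w →
  mat x y z w ∷ []) (allFinL N)) (allFinL N)) (allFinL N)) (allFinL N)

card : ∀ {N} → Subset₂ N → ℕ
card {N} H = length (filterᵇ H (allMats N))

_==_ : ∀ {N} → Mat N → Mat N → Bool
A == B = ⌊ a A ≟ᶠ a B ⌋ ∧ ⌊ b A ≟ᶠ b B ⌋ ∧ ⌊ c A ≟ᶠ c B ⌋ ∧ ⌊ d A ≟ᶠ d B ⌋

π : ∀ {M} (p : ℕ) → Prime p → Mat M → Mat p
π p pp A = mat (r (a A)) (r (b A)) (r (c A)) (r (d A))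
  where
  instance _ = prime⇒nonZero pp
  r : ∀ {M} → Fin M → Fin p
  r x = toℕ x mod p

image : ∀ {M} (p : ℕ) → Prime p → Subset₂ M → Subset₂ p
image {M} p pp H x = any (λ g → H g ∧ (π p pp g == x)) (allMats M)

UpperTendencies : (ℓ n m : ℕ) → Subset₂ (ℓ ^ n) → Set
UpperTendencies ℓ n m H =
  ∀ g → T (H g) → (ℓ ^ m) ∣ toℕ (c g) → (ℓ ^ n) ∣ toℕ (c g)

UpperTriangularMod : (p n : ℕ) → Subset₂ (p ^ n) → Set
UpperTriangularMod p n H = ∀ g → T (H g) → p ∣ toℕ (c g)

{-# OPTIONS --safe #-}
-- Let K be the kernel of reduction mod p restricted to H. Left translation by an inverse maps
-- each fibre of π on H injectively into K, so |H| ≤ |K| · |π(H)|. An element k of K is the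
-- identity mod p, so by the tendency hypothesis it is upper triangular mod pⁿ, and so are
-- t k t⁻¹ and t⁻¹ k t for every t ∈ H. If c_t is a unit, comparing the bottom rows of
-- t k = (t k t⁻¹) t and the first columns of t (t⁻¹ k t) = k t gives
--   c_t b_k = d_t (a_k − d_k)   and   c_t b_k = a_t (d_k − a_k).
-- The first shows that k is determined by its diagonal, whose entries are ≡ 1 mod p, so
-- |K| ≤ (p^(n−1))². Adding the two, a unit trace forces a_k = d_k and b_k = 0, so |K| ≤ p^(n−1).
module Submission where

open import Defs
open import Algebra.Bundles using (CommutativeRing)
open import Algebra.Consequences.Propositional using (comm∧idˡ⇒id; comm∧invˡ⇒inv; comm∧distrʳ⇒distrˡ)
open import Algebra.Definitions using (Associative; Commutative; LeftIdentity; LeftInverse; _DistributesOverʳ_)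
import Algebra.Properties.Ring as RingProperties
import Algebra.Solver.Ring.NaturalCoefficients.Default as SemiringSolver
open import Data.Bool using (T; _∧_)
open import Data.Bool.Properties using (T-∧)
open import Data.Empty using (⊥-elim)
open import Data.Fin using (Fin; toℕ)
open import Data.Fin.Properties using (toℕ-fromℕ<; toℕ-injective; toℕ<n) renaming (_≟_ to _≟ᶠ_)
open import Data.List using (List; []; _∷_; _++_; length; map; filter; filterᵇ; concatMap; cartesianProduct; allFin; upTo)
open import Data.List.Properties using (length-++; length-map; length-upTo)
open import Data.List.Membership.Propositional using (_∈_)
open import Data.List.Membership.Propositional.Properties
  using (∈-∃++; ∈-++⁻; ∈-++⁺ˡ; ∈-++⁺ʳ; ∈-filter⁺; ∈-filter⁻; ∈-concatMap⁺; ∈-allFin; ∈-upTo⁺; ∈-cartesianProduct⁺)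
open import Data.List.Relation.Binary.Disjoint.Propositional using (Disjoint)
open import Data.List.Relation.Binary.Sublist.Propositional.Properties using (filter-⊆; filter⁺; length-mono-≤)
open import Data.List.Relation.Unary.All as All using (All; []; _∷_)
import Data.List.Relation.Unary.All.Properties as All
open import Data.List.Relation.Unary.AllPairs as AllPairs using ([]; _∷_)
import Data.List.Relation.Unary.AllPairs.Properties as AllPairs
open import Data.List.Relation.Unary.Any as Any using (here; there; satisfied; any?)
open import Data.List.Relation.Unary.Any.Properties using (any⁺)
open import Data.List.Relation.Unary.Unique.Propositional using (Unique)
import Data.List.Relation.Unary.Unique.Propositional.Properties as Unique
open import Data.Nat as ℕ using (ℕ; zero; suc; NonZero; _≤_; _<_; _^_; _∸_; z≤n; s≤s)
import Data.Nat.Properties as ℕ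
open import Data.Nat.Divisibility
  using (_∣_; _∣?_; _∣0; 1∣_; divides; ∣-trans; m∣m*n; *-monoˡ-∣; *-cancelʳ-∣; m%n≡0⇒n∣m; n∣m⇒m%n≡0)
open import Data.Nat.DivMod
  using (_%_; _/_; _mod_; m%n<n; m<n⇒m%n≡m; %-distribˡ-+; %-distribˡ-*; [m+n]%n≡m%n; m∣n⇒o%n%m≡o%m;
         m≡m%n+[m/n]*n; m<n*o⇒m/o<n)
open import Data.Nat.Primality using (Prime; prime⇒nonZero; euclidsLemma)
open import Data.Product using (Σ; _×_; _,_; proj₁; proj₂)
open import Data.Sum using (inj₁; inj₂)
open import Function using (Equivalence; _∘_)
open import Level using (0ℓ)
open import Relation.Binary.Definitions using (DecidableEquality)
open import Relation.Binary.PropositionalEquality hiding ([_])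
open import Relation.Nullary using (¬_; ¬?; yes; no; contradiction)
open import Relation.Nullary.Decidable using (T?; toWitness; fromWitness; map′; _×-dec_; decidable-stable)
open import Relation.Unary using (Decidable)

p^n∣c*x⇒p^n∣x : ∀ {p} n {c x} → Prime p → ¬ p ∣ c → p ^ n ∣ c ℕ.* x → p ^ n ∣ x
p^n∣c*x⇒p^n∣x zero    {x = x} _ _ _ = 1∣ x
p^n∣c*x⇒p^n∣x {p} (suc n) {c} {x} pp p∤c p^[1+n]∣cx
  with euclidsLemma c x pp (∣-trans (m∣m*n (p ^ n)) p^[1+n]∣cx)
... | inj₁ p∣c             = contradiction p∣c p∤c
... | inj₂ (divides q refl) = subst (_∣ q ℕ.* p) (ℕ.*-comm (p ^ n) p) (*-monoˡ-∣ p p^n∣q)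
  where
  instance _ = prime⇒nonZero pp
  p^n∣q : p ^ n ∣ q
  p^n∣q = p^n∣c*x⇒p^n∣x n pp p∤c
    (*-cancelʳ-∣ p (subst₂ _∣_ (ℕ.*-comm p (p ^ n)) (sym (ℕ.*-assoc c q p)) p^[1+n]∣cx))

%∧/⇒≡ : ∀ {m o} n .{{_ : NonZero n}} → m % n ≡ o % n → m / n ≡ o / n → m ≡ o
%∧/⇒≡ {m} {o} n m%n≡o%n m/n≡o/n = begin
  m                     ≡⟨ m≡m%n+[m/n]*n m n ⟩
  m % n ℕ.+ m / n ℕ.* n ≡⟨ cong₂ (λ r q → r ℕ.+ q ℕ.* n) m%n≡o%n m/n≡o/n ⟩
  o % n ℕ.+ o / n ℕ.* n ≡⟨ m≡m%n+[m/n]*n o n ⟨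
  o                     ∎
  where open ≡-Reasoning

m^n≡m^[n∸1]*m : ∀ m {n} → 1 ≤ n → m ^ n ≡ m ^ (n ∸ 1) ℕ.* m
m^n≡m^[n∸1]*m m {suc n} _ = ℕ.*-comm m (m ^ n)

m∣m^n : ∀ m {n} → 1 ≤ n → m ∣ m ^ n
m∣m^n m {suc n} _ = m∣m*n (m ^ n)

m^[2n∸2]≡m^[n∸1]*m^[n∸1] : ∀ m {n} → 1 ≤ n → m ^ (2 ℕ.* n ∸ 2) ≡ m ^ (n ∸ 1) ℕ.* m ^ (n ∸ 1)
m^[2n∸2]≡m^[n∸1]*m^[n∸1] m {suc n} _ = begin
  m ^ (2 ℕ.* suc n ∸ 2)          ≡⟨⟩
  m ^ (n ℕ.+ suc (n ℕ.+ 0) ∸ 1)  ≡⟨ cong (λ e → m ^ (e ∸ 1)) (ℕ.+-suc n (n ℕ.+ 0)) ⟩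
  m ^ (n ℕ.+ (n ℕ.+ 0))          ≡⟨ cong (λ e → m ^ (n ℕ.+ e)) (ℕ.+-identityʳ n) ⟩
  m ^ (n ℕ.+ n)                  ≡⟨ ℕ.^-distribˡ-+-* m n n ⟩
  m ^ n ℕ.* m ^ n                ∎
  where open ≡-Reasoning

-- Counting with lists

module _ {A B : Set} where

  length-cartesianProduct : (xs : List A) (ys : List B) →
                            length (cartesianProduct xs ys) ≡ length xs ℕ.* length ys
  length-cartesianProduct []       ys = refl
  length-cartesianProduct (x ∷ xs) ys = begin
    length (map (x ,_) ys ++ cartesianProduct xs ys)  ≡⟨ length-++ (map (x ,_) ys) ⟩
    length (map (x ,_) ys) ℕ.+ length (cartesianProduct xs ys)
      ≡⟨ cong₂ ℕ._+_ (length-map (x ,_) ys) (length-cartesianProduct xs ys) ⟩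
    length ys ℕ.+ length xs ℕ.* length ys                 ∎
    where open ≡-Reasoning

  injectiveOn⇒length≤ : (f : A → B) {xs : List A} {ys : List B} → Unique xs →
                        (∀ {x} → x ∈ xs → f x ∈ ys) →
                        (∀ {x y} → x ∈ xs → y ∈ xs → f x ≡ f y → x ≡ y) →
                        length xs ≤ length ys
  injectiveOn⇒length≤ f {[]}     _           _    _   = z≤n
  injectiveOn⇒length≤ f {x ∷ xs} (x∉xs ∷ xs!) into inj with ∈-∃++ (into (here refl))
  ... | us , vs , refl = begin
    suc (length xs)             ≤⟨ s≤s (injectiveOn⇒length≤ f xs! into′ (λ u v → inj (there u) (there v))) ⟩
    suc (length (us ++ vs))     ≡⟨ cong suc (length-++ us) ⟩
    suc (length us ℕ.+ length vs) ≡⟨ ℕ.+-suc (length us) (length vs) ⟨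
    length us ℕ.+ length (f x ∷ vs) ≡⟨ length-++ us ⟨
    length (us ++ f x ∷ vs)     ∎
    where
    open ℕ.≤-Reasoning
    into′ : ∀ {z} → z ∈ xs → f z ∈ us ++ vs
    into′ {z} z∈xs with ∈-++⁻ us (into (there z∈xs))
    ... | inj₁ fz∈us         = ∈-++⁺ˡ fz∈us
    ... | inj₂ (here fz≡fx)  = ⊥-elim (All.lookup x∉xs z∈xs (inj (here refl) (there z∈xs) (sym fz≡fx)))
    ... | inj₂ (there fz∈vs) = ∈-++⁺ʳ us fz∈vs

  All-concatMap : {P : B → Set} {f : A → List B} → (∀ x → All P (f x)) → ∀ xs → All P (concatMap f xs)
  All-concatMap Pf xs = All.concat⁺ (All.map⁺ (All.universal (Pf) xs))

  ∈-concatMap : {f : A → List B} {x : A} {y : B} {xs : List A} → x ∈ xs → y ∈ f x → y ∈ concatMap f xs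
  ∈-concatMap {f} x∈xs y∈fx = ∈-concatMap⁺ f (Any.map (λ { refl → y∈fx }) x∈xs)

  concatMap-Unique : {f : A → List B} (g : B → A) → (∀ x → All (λ y → g y ≡ x) (f x)) →
                     (∀ x → Unique (f x)) → {xs : List A} → Unique xs → Unique (concatMap f xs)
  concatMap-Unique {f} g tagged f! xs! =
    Unique.concat⁺ (All.map⁺ (All.universal f! _)) (AllPairs.map⁺ (AllPairs.map disjoint xs!))
    where
    disjoint : ∀ {x x′} → x ≢ x′ → Disjoint (f x) (f x′)
    disjoint {x} {x′} x≢x′ (y∈fx , y∈fx′) =
      x≢x′ (trans (sym (All.lookup (tagged x) y∈fx)) (All.lookup (tagged x′) y∈fx′))

  length-filter+length-filter¬ : {P : A → Set} (P? : Decidable P) (xs : List A) →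
                                 length (filter P? xs) ℕ.+ length (filter (¬? ∘ P?) xs) ≡ length xs
  length-filter+length-filter¬ P? []       = refl
  length-filter+length-filter¬ P? (x ∷ xs) with P? x
  ... | yes _ = cong suc (length-filter+length-filter¬ P? xs)
  ... | no  _ = trans (ℕ.+-suc _ _) (cong suc (length-filter+length-filter¬ P? xs))

  module _ (f : A → B) (_≟_ : DecidableEquality B) where

    fibre : B → List A → List A
    fibre y = filter (λ x → f x ≟ y)

    private
      inhabited-bound : ∀ {m} (zs : List A) → (∀ {z} → z ∈ zs → length zs ≤ m) → length zs ≤ m
      inhabited-bound []       _     = z≤n
      inhabited-bound (z ∷ zs) bound = bound (here refl)

    fibres≤⇒length≤ : ∀ {m} (ys : List B) {xs : List A} → (∀ {x} → x ∈ xs → f x ∈ ys) →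
                      (∀ {x} → x ∈ xs → length (fibre (f x) xs) ≤ m) →
                      length xs ≤ length ys ℕ.* m
    fibres≤⇒length≤ []       {[]}    _    _     = z≤n
    fibres≤⇒length≤ []       {x ∷ _} into _     with () ← into (here refl)
    fibres≤⇒length≤ {m} (y ∷ ys) {xs} into bound = begin
      length xs                                ≡⟨ length-filter+length-filter¬ (λ x → f x ≟ y) xs ⟨
      length (fibre y xs) ℕ.+ length rest      ≤⟨ ℕ.+-mono-≤ fibre-y≤m (fibres≤⇒length≤ ys into′ bound′) ⟩
      m ℕ.+ length ys ℕ.* m                    ∎
      where
      open ℕ.≤-Reasoning
      rest : List A
      rest = filter (λ x → ¬? (f x ≟ y)) xs
      fibre-y≤m : length (fibre y xs) ≤ m
      fibre-y≤m = inhabited-bound (fibre y xs) λ z∈ → let z∈xs , fz≡y = ∈-filter⁻ (λ x → f x ≟ y) z∈ in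
        subst (λ w → length (fibre w xs) ≤ m) fz≡y (bound z∈xs)
      into′ : ∀ {x} → x ∈ rest → f x ∈ ys
      into′ x∈ with ∈-filter⁻ (λ x → ¬? (f x ≟ y)) x∈
      ... | x∈xs , fx≢y with into x∈xs
      ...   | here fx≡y = ⊥-elim (fx≢y fx≡y)
      ...   | there fx∈ys = fx∈ys
      bound′ : ∀ {x} → x ∈ rest → length (fibre (f x) rest) ≤ m
      bound′ {x} x∈ = ℕ.≤-trans (length-mono-≤ (filter⁺ _ _ (λ { refl fx≡ → fx≡ }) (filter-⊆ _ xs)))
                              (bound (proj₁ (∈-filter⁻ _ x∈)))


-- The ring ℤ/Nℤ

⊕≡mod : ∀ {N} .{{_ : NonZero N}} (x y : Fin N) → x ⊕ y ≡ (toℕ x ℕ.+ toℕ y) mod N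
⊕≡mod {suc _} x y = refl

⊗≡mod : ∀ {N} .{{_ : NonZero N}} (x y : Fin N) → x ⊗ y ≡ (toℕ x ℕ.* toℕ y) mod N
⊗≡mod {suc _} x y = refl

module _ {N : ℕ} .{{_ : NonZero N}} where

  [_] : ℕ → Fin N
  [ m ] = m mod N

  toℕ-[] : ∀ m → toℕ [ m ] ≡ m % N
  toℕ-[] m = toℕ-fromℕ< (m%n<n m N)

  [toℕ] : (x : Fin N) → [ toℕ x ] ≡ x
  [toℕ] x = toℕ-injective (trans (toℕ-[] (toℕ x)) (m<n⇒m%n≡m (toℕ<n x)))

  []≡[]⇒%≡% : ∀ {m n} → [ m ] ≡ [ n ] → m % N ≡ n % N
  []≡[]⇒%≡% {m} {n} [m]≡[n] = trans (sym (toℕ-[] m)) (trans (cong toℕ [m]≡[n]) (toℕ-[] n))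

  private
    0%N≡0 : 0 % N ≡ 0
    0%N≡0 = n∣m⇒m%n≡0 0 N (N ∣0)

  []≡[0]⇒∣ : ∀ {m} → [ m ] ≡ [ 0 ] → N ∣ m
  []≡[0]⇒∣ {m} [m]≡[0] = m%n≡0⇒n∣m m N (trans ([]≡[]⇒%≡% [m]≡[0]) 0%N≡0)

  ∣⇒≡[0] : (x : Fin N) → N ∣ toℕ x → x ≡ [ 0 ]
  ∣⇒≡[0] x N∣x = toℕ-injective (begin
    toℕ x         ≡⟨ m<n⇒m%n≡m (toℕ<n x) ⟨
    toℕ x % N     ≡⟨ n∣m⇒m%n≡0 (toℕ x) N N∣x ⟩
    0             ≡⟨ 0%N≡0 ⟨
    0 % N         ≡⟨ toℕ-[] 0 ⟨
    toℕ [ 0 ]     ∎)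
    where open ≡-Reasoning

  private
    hom : (_∙_ : ℕ → ℕ → ℕ) (_◦_ : Fin N → Fin N → Fin N) →
          (∀ x y → x ◦ y ≡ [ toℕ x ∙ toℕ y ]) → (∀ m n → (m ∙ n) % N ≡ ((m % N) ∙ (n % N)) % N) →
          ∀ m n → [ m ∙ n ] ≡ [ m ] ◦ [ n ]
    hom _∙_ _◦_ ◦-def %-distrib m n = toℕ-injective (begin
      toℕ [ m ∙ n ]                         ≡⟨ toℕ-[] (m ∙ n) ⟩
      (m ∙ n) % N                           ≡⟨ %-distrib m n ⟩
      ((m % N) ∙ (n % N)) % N               ≡⟨ cong₂ (λ u v → (u ∙ v) % N) (toℕ-[] m) (toℕ-[] n) ⟨
      (toℕ [ m ] ∙ toℕ [ n ]) % N           ≡⟨ toℕ-[] _ ⟨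
      toℕ [ toℕ [ m ] ∙ toℕ [ n ] ]         ≡⟨ cong toℕ (◦-def [ m ] [ n ]) ⟨
      toℕ ([ m ] ◦ [ n ])                   ∎)
      where open ≡-Reasoning

  [+] : ∀ m n → [ m ℕ.+ n ] ≡ [ m ] ⊕ [ n ]
  [+] = hom ℕ._+_ _⊕_ ⊕≡mod (λ m n → %-distribˡ-+ m n N)

  [*] : ∀ m n → [ m ℕ.* n ] ≡ [ m ] ⊗ [ n ]
  [*] = hom ℕ._*_ _⊗_ ⊗≡mod (λ m n → %-distribˡ-* m n N)

  ⊖_ : Fin N → Fin N
  ⊖ x = [ N ℕ.∸ toℕ x ]

  -- Every element of ℤ/Nℤ is [ m ] for some m ∈ ℕ, so the semiring laws of ℕ transfer along [_].
  private
    open ≡-Reasoning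

    lift₁ : {P : Fin N → Set} → (∀ l → P [ l ]) → ∀ x → P x
    lift₁ {P} h x = subst P ([toℕ] x) (h (toℕ x))

    lift₂ : {P : Fin N → Fin N → Set} → (∀ l m → P [ l ] [ m ]) → ∀ x y → P x y
    lift₂ {P} h x y = subst₂ P ([toℕ] x) ([toℕ] y) (h (toℕ x) (toℕ y))

    lift₃ : {P : Fin N → Fin N → Fin N → Set} → (∀ l m n → P [ l ] [ m ] [ n ]) → ∀ x y z → P x y z
    lift₃ {P} h x y z = lift₁ {λ x → P x y z} (λ l → lift₂ {P [ l ]} (h l) y z) x

    ⊕-assoc : Associative _≡_ _⊕_
    ⊕-assoc = lift₃ λ l m n → begin
      ([ l ] ⊕ [ m ]) ⊕ [ n ] ≡⟨ cong (_⊕ [ n ]) ([+] l m) ⟨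
      [ l ℕ.+ m ] ⊕ [ n ]     ≡⟨ [+] (l ℕ.+ m) n ⟨
      [ l ℕ.+ m ℕ.+ n ]       ≡⟨ cong [_] (ℕ.+-assoc l m n) ⟩
      [ l ℕ.+ (m ℕ.+ n) ]     ≡⟨ [+] l (m ℕ.+ n) ⟩
      [ l ] ⊕ [ m ℕ.+ n ]     ≡⟨ cong ([ l ] ⊕_) ([+] m n) ⟩
      [ l ] ⊕ ([ m ] ⊕ [ n ]) ∎

    ⊕-comm : Commutative _≡_ _⊕_
    ⊕-comm = lift₂ λ m n → begin
      [ m ] ⊕ [ n ] ≡⟨ [+] m n ⟨
      [ m ℕ.+ n ]   ≡⟨ cong [_] (ℕ.+-comm m n) ⟩
      [ n ℕ.+ m ]   ≡⟨ [+] n m ⟩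
      [ n ] ⊕ [ m ] ∎

    ⊕-identityˡ : LeftIdentity _≡_ [ 0 ] _⊕_
    ⊕-identityˡ = lift₁ λ m → sym ([+] 0 m)

    ⊖-inverseˡ : LeftInverse _≡_ [ 0 ] ⊖_ _⊕_
    ⊖-inverseˡ x = begin
      (⊖ x) ⊕ x                            ≡⟨ cong ((⊖ x) ⊕_) ([toℕ] x) ⟨
      [ N ℕ.∸ toℕ x ] ⊕ [ toℕ x ]          ≡⟨ [+] (N ℕ.∸ toℕ x) (toℕ x) ⟨
      [ N ℕ.∸ toℕ x ℕ.+ toℕ x ]            ≡⟨ cong [_] (ℕ.m∸n+n≡m (ℕ.<⇒≤ (toℕ<n x))) ⟩
      [ N ]                                ≡⟨ toℕ-injective (trans (toℕ-[] N)
                                                (trans ([m+n]%n≡m%n 0 N) (sym (toℕ-[] 0)))) ⟩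
      [ 0 ]                                ∎

    ⊗-assoc : Associative _≡_ _⊗_
    ⊗-assoc = lift₃ λ l m n → begin
      ([ l ] ⊗ [ m ]) ⊗ [ n ] ≡⟨ cong (_⊗ [ n ]) ([*] l m) ⟨
      [ l ℕ.* m ] ⊗ [ n ]     ≡⟨ [*] (l ℕ.* m) n ⟨
      [ l ℕ.* m ℕ.* n ]       ≡⟨ cong [_] (ℕ.*-assoc l m n) ⟩
      [ l ℕ.* (m ℕ.* n) ]     ≡⟨ [*] l (m ℕ.* n) ⟩
      [ l ] ⊗ [ m ℕ.* n ]     ≡⟨ cong ([ l ] ⊗_) ([*] m n) ⟩
      [ l ] ⊗ ([ m ] ⊗ [ n ]) ∎

    ⊗-comm : Commutative _≡_ _⊗_
    ⊗-comm = lift₂ λ m n → begin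
      [ m ] ⊗ [ n ] ≡⟨ [*] m n ⟨
      [ m ℕ.* n ]   ≡⟨ cong [_] (ℕ.*-comm m n) ⟩
      [ n ℕ.* m ]   ≡⟨ [*] n m ⟩
      [ n ] ⊗ [ m ] ∎

    ⊗-identityˡ : LeftIdentity _≡_ [ 1 ] _⊗_
    ⊗-identityˡ = lift₁ λ m → trans (sym ([*] 1 m)) (cong [_] (ℕ.*-identityˡ m))

    ⊗-distribʳ-⊕ : _DistributesOverʳ_ _≡_ _⊗_ _⊕_
    ⊗-distribʳ-⊕ = lift₃ λ l m n → begin
      ([ m ] ⊕ [ n ]) ⊗ [ l ]             ≡⟨ cong (_⊗ [ l ]) ([+] m n) ⟨
      [ m ℕ.+ n ] ⊗ [ l ]                 ≡⟨ [*] (m ℕ.+ n) l ⟨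
      [ (m ℕ.+ n) ℕ.* l ]                 ≡⟨ cong [_] (ℕ.*-distribʳ-+ l m n) ⟩
      [ m ℕ.* l ℕ.+ n ℕ.* l ]             ≡⟨ [+] (m ℕ.* l) (n ℕ.* l) ⟩
      [ m ℕ.* l ] ⊕ [ n ℕ.* l ]           ≡⟨ cong₂ _⊕_ ([*] m l) ([*] n l) ⟩
      ([ m ] ⊗ [ l ]) ⊕ ([ n ] ⊗ [ l ])   ∎

  commutativeRing : CommutativeRing 0ℓ 0ℓ
  commutativeRing = record
    { Carrier = Fin N ; _≈_ = _≡_ ; _+_ = _⊕_ ; _*_ = _⊗_ ; -_ = ⊖_ ; 0# = [ 0 ] ; 1# = [ 1 ]
    ; isCommutativeRing = record
      { isRing = record
        { +-isAbelianGroup = record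
          { isGroup = record
            { isMonoid = record
              { isSemigroup = record
                { isMagma = record { isEquivalence = isEquivalence ; ∙-cong = cong₂ _⊕_ }
                ; assoc = ⊕-assoc }
              ; identity = comm∧idˡ⇒id ⊕-comm ⊕-identityˡ }
            ; inverse = comm∧invˡ⇒inv ⊕-comm ⊖-inverseˡ
            ; ⁻¹-cong = cong ⊖_ }
          ; comm = ⊕-comm }
        ; *-cong = cong₂ _⊗_
        ; *-assoc = ⊗-assoc
        ; *-identity = comm∧idˡ⇒id ⊗-comm ⊗-identityˡ
        ; distrib = comm∧distrʳ⇒distrˡ ⊗-comm ⊗-distribʳ-⊕ , ⊗-distribʳ-⊕ }
      ; *-comm = ⊗-comm } }

ℤ/_ℤ : (N : ℕ) .{{_ : NonZero N}} → CommutativeRing 0ℓ 0ℓ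
ℤ/ N ℤ = commutativeRing {N}



module _ {N : ℕ} where

  ≡-mat : ∀ {A B : Mat N} → a A ≡ a B → b A ≡ b B → c A ≡ c B → d A ≡ d B → A ≡ B
  ≡-mat refl refl refl refl = refl

  ==⇒≡ : ∀ {A B : Mat N} → T (A == B) → A ≡ B
  ==⇒≡ {A} {B} A==B with Equivalence.to T-∧ A==B
  ... | a≡ , bcd≡ with Equivalence.to T-∧ bcd≡
  ...   | b≡ , cd≡ with Equivalence.to T-∧ cd≡
  ...     | c≡ , d≡ = ≡-mat (toWitness {a? = a A ≟ᶠ a B} a≡) (toWitness {a? = b A ≟ᶠ b B} b≡)
                            (toWitness {a? = c A ≟ᶠ c B} c≡) (toWitness {a? = d A ≟ᶠ d B} d≡)

  ≡⇒== : ∀ {A B : Mat N} → A ≡ B → T (A == B)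
  ≡⇒== {mat x y z w} refl = Equivalence.from T-∧ (fromWitness {a? = x ≟ᶠ x} refl ,
    Equivalence.from T-∧ (fromWitness {a? = y ≟ᶠ y} refl ,
    Equivalence.from T-∧ (fromWitness {a? = z ≟ᶠ z} refl , fromWitness {a? = w ≟ᶠ w} refl)))

  _≟ᴹ_ : DecidableEquality (Mat N)
  A ≟ᴹ B = map′ ==⇒≡ ≡⇒== (T? (A == B))

  private
    withABC : Fin N → Fin N → Fin N → List (Mat N)
    withABC x y z = concatMap (λ w → mat x y z w ∷ []) (allFin N)
    withAB : Fin N → Fin N → List (Mat N)
    withAB x y = concatMap (withABC x y) (allFin N)
    withA : Fin N → List (Mat N)
    withA x = concatMap (withAB x) (allFin N)

  ∈-allMats : (A : Mat N) → A ∈ allMats N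
  ∈-allMats (mat x y z w) =
    ∈-concatMap {f = withA} (∈-allFin x) (∈-concatMap {f = withAB x} (∈-allFin y)
      (∈-concatMap {f = withABC x y} (∈-allFin z) (∈-concatMap (∈-allFin w) (here refl))))

  allMats-Unique : Unique (allMats N)
  allMats-Unique =
    concatMap-Unique {f = withA} a withA-entries
      (λ x → concatMap-Unique {f = withAB x} b (withAB-entries x)
        (λ y → concatMap-Unique {f = withABC x y} c (λ z → All.map (proj₂ ∘ proj₂) (withABC-entries x y z))
          (λ z → concatMap-Unique d (λ w → refl ∷ []) (λ w → [] ∷ []) fins!) fins!) fins!) fins!
    where
    fins! = Unique.allFin⁺ N
    withABC-entries : ∀ x y z → All (λ A → a A ≡ x × b A ≡ y × c A ≡ z) (withABC x y z)
    withABC-entries x y z = All-concatMap {f = λ w → mat x y z w ∷ []} (λ w → (refl , refl , refl) ∷ []) (allFin N)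
    withAB-entries : ∀ x y → All (λ A → b A ≡ y) (withAB x y)
    withAB-entries x y = All-concatMap {f = withABC x y} (λ z → All.map (proj₁ ∘ proj₂) (withABC-entries x y z)) (allFin N)
    withA-entries : ∀ x → All (λ A → a A ≡ x) (withA x)
    withA-entries x = All-concatMap {f = withAB x}
      (λ y → All-concatMap {f = withABC x y} (λ z → All.map proj₁ (withABC-entries x y z)) (allFin N)) (allFin N)

  elements : Subset₂ N → List (Mat N)
  elements S = filterᵇ S (allMats N)

  ∈-elements⁺ : ∀ {S A} → T (S A) → A ∈ elements S
  ∈-elements⁺ {S} {A} = ∈-filter⁺ (T? ∘ S) (∈-allMats A)

  ∈-elements⁻ : ∀ {S A} → A ∈ elements S → T (S A)
  ∈-elements⁻ {S} A∈S = proj₂ (∈-filter⁻ (T? ∘ S) {xs = allMats N} A∈S)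

  elements-Unique : ∀ S → Unique (elements S)
  elements-Unique S = Unique.filter⁺ (T? ∘ S) allMats-Unique

module _ {N : ℕ} .{{_ : NonZero N}} where
  open CommutativeRing (ℤ/ N ℤ) using (+-identityˡ; +-identityʳ; *-identityˡ; *-identityʳ; zeroˡ; zeroʳ)
  open SemiringSolver (CommutativeRing.commutativeSemiring (ℤ/ N ℤ))

  mul-assoc : ∀ (A B C : Mat N) → mul (mul A B) C ≡ mul A (mul B C)
  mul-assoc A B C = ≡-mat (row (a A) (b A) (a C) (c C)) (row (a A) (b A) (b C) (d C))
                          (row (c A) (d A) (a C) (c C)) (row (c A) (d A) (b C) (d C))
    where
    entry : ∀ u₁ u₂ v₁₁ v₁₂ v₂₁ v₂₂ w₁ w₂ →
            (((u₁ ⊗ v₁₁) ⊕ (u₂ ⊗ v₂₁)) ⊗ w₁) ⊕ (((u₁ ⊗ v₁₂) ⊕ (u₂ ⊗ v₂₂)) ⊗ w₂)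
            ≡ (u₁ ⊗ ((v₁₁ ⊗ w₁) ⊕ (v₁₂ ⊗ w₂))) ⊕ (u₂ ⊗ ((v₂₁ ⊗ w₁) ⊕ (v₂₂ ⊗ w₂)))
    entry = solve 8 (λ u₁ u₂ v₁₁ v₁₂ v₂₁ v₂₂ w₁ w₂ →
      (u₁ :* v₁₁ :+ u₂ :* v₂₁) :* w₁ :+ (u₁ :* v₁₂ :+ u₂ :* v₂₂) :* w₂
      := u₁ :* (v₁₁ :* w₁ :+ v₁₂ :* w₂) :+ u₂ :* (v₂₁ :* w₁ :+ v₂₂ :* w₂)) refl
    row = λ u₁ u₂ w₁ w₂ → entry u₁ u₂ (a B) (b B) (c B) (d B) w₁ w₂

  private
    1x+0y≡x : ∀ x y → ([ 1 ] ⊗ x) ⊕ ([ 0 ] ⊗ y) ≡ x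
    1x+0y≡x x y = trans (cong₂ _⊕_ (*-identityˡ x) (zeroˡ y)) (+-identityʳ x)
    0x+1y≡y : ∀ x y → ([ 0 ] ⊗ x) ⊕ ([ 1 ] ⊗ y) ≡ y
    0x+1y≡y x y = trans (cong₂ _⊕_ (zeroˡ x) (*-identityˡ y)) (+-identityˡ y)
    x1+y0≡x : ∀ x y → (x ⊗ [ 1 ]) ⊕ (y ⊗ [ 0 ]) ≡ x
    x1+y0≡x x y = trans (cong₂ _⊕_ (*-identityʳ x) (zeroʳ y)) (+-identityʳ x)
    x0+y1≡y : ∀ x y → (x ⊗ [ 0 ]) ⊕ (y ⊗ [ 1 ]) ≡ y
    x0+y1≡y x y = trans (cong₂ _⊕_ (zeroʳ x) (*-identityʳ y)) (+-identityˡ y)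

  mul-identityˡ : ∀ A → mul (I N) A ≡ A
  mul-identityˡ A = ≡-mat (1x+0y≡x (a A) (c A)) (1x+0y≡x (b A) (d A)) (0x+1y≡y (a A) (c A)) (0x+1y≡y (b A) (d A))

  mul-identityʳ : ∀ A → mul A (I N) ≡ A
  mul-identityʳ A = ≡-mat (x1+y0≡x (a A) (b A)) (x0+y1≡y (a A) (b A)) (x1+y0≡x (c A) (d A)) (x0+y1≡y (c A) (d A))

  module _ {g h : Mat N} where
    open ≡-Reasoning

    mul-cancelˡ : ∀ {A B} → mul h g ≡ I N → mul g A ≡ mul g B → A ≡ B
    mul-cancelˡ {A} {B} hg≡I gA≡gB = begin
      A                 ≡⟨ mul-identityˡ A ⟨
      mul (I N) A       ≡⟨ cong (λ X → mul X A) hg≡I ⟨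
      mul (mul h g) A   ≡⟨ mul-assoc h g A ⟩
      mul h (mul g A)   ≡⟨ cong (mul h) gA≡gB ⟩
      mul h (mul g B)   ≡⟨ mul-assoc h g B ⟨
      mul (mul h g) B   ≡⟨ cong (λ X → mul X B) hg≡I ⟩
      mul (I N) B       ≡⟨ mul-identityˡ B ⟩
      B                 ∎

    conjugate-intertwinesʳ : ∀ k → mul h g ≡ I N → mul (mul (mul g k) h) g ≡ mul g k
    conjugate-intertwinesʳ k hg≡I = begin
      mul (mul (mul g k) h) g ≡⟨ mul-assoc (mul g k) h g ⟩
      mul (mul g k) (mul h g) ≡⟨ cong (mul (mul g k)) hg≡I ⟩
      mul (mul g k) (I N)     ≡⟨ mul-identityʳ (mul g k) ⟩
      mul g k                 ∎

    conjugate-intertwinesˡ : ∀ k → mul g h ≡ I N → mul g (mul (mul h k) g) ≡ mul k g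
    conjugate-intertwinesˡ k gh≡I = begin
      mul g (mul (mul h k) g) ≡⟨ mul-assoc g (mul h k) g ⟨
      mul (mul g (mul h k)) g ≡⟨ cong (λ X → mul X g) (mul-assoc g h k) ⟨
      mul (mul (mul g h) k) g ≡⟨ cong (λ X → mul (mul X k) g) gh≡I ⟩
      mul (mul (I N) k) g     ≡⟨ cong (λ X → mul X g) (mul-identityˡ k) ⟩
      mul k g                 ∎

reduce : ∀ {N} p .{{_ : NonZero p}} → Fin N → Fin p
reduce p x = [ toℕ x ]

module _ {p N : ℕ} .{{_ : NonZero p}} .{{_ : NonZero N}} (p∣N : p ∣ N) where

  reduce-[] : ∀ m → reduce p [ m ] ≡ [ m ]
  reduce-[] m = toℕ-injective (begin
    toℕ [ toℕ [ m ] ]     ≡⟨ toℕ-[] _ ⟩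
    toℕ [ m ] % p         ≡⟨ cong (_% p) (toℕ-[] m) ⟩
    m % N % p             ≡⟨ m∣n⇒o%n%m≡o%m p N m p∣N ⟩
    m % p                 ≡⟨ toℕ-[] m ⟨
    toℕ [ m ]             ∎)
    where open ≡-Reasoning

  reduce-⊕ : ∀ x y → reduce p (x ⊕ y) ≡ reduce p x ⊕ reduce p y
  reduce-⊕ x y = trans (cong (reduce p) (⊕≡mod x y)) (trans (reduce-[] _) ([+] (toℕ x) (toℕ y)))

  reduce-⊗ : ∀ x y → reduce p (x ⊗ y) ≡ reduce p x ⊗ reduce p y
  reduce-⊗ x y = trans (cong (reduce p) (⊗≡mod x y)) (trans (reduce-[] _) ([*] (toℕ x) (toℕ y)))

module _ {p : ℕ} (pp : Prime p) {N : ℕ} .{{_ : NonZero N}} (p∣N : p ∣ N) where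
  private instance _ = prime⇒nonZero pp

  π-mul : ∀ A B → π p pp (mul A B) ≡ mul (π p pp A) (π p pp B)
  π-mul A B = ≡-mat (dot (a A) (a B) (b A) (c B)) (dot (a A) (b B) (b A) (d B))
                    (dot (c A) (a B) (d A) (c B)) (dot (c A) (b B) (d A) (d B))
    where
    dot : ∀ x y z w → reduce p ((x ⊗ y) ⊕ (z ⊗ w)) ≡ (reduce p x ⊗ reduce p y) ⊕ (reduce p z ⊗ reduce p w)
    dot x y z w = trans (reduce-⊕ p∣N (x ⊗ y) (z ⊗ w)) (cong₂ _⊕_ (reduce-⊗ p∣N x y) (reduce-⊗ p∣N z w))

  π-I : π p pp (I N) ≡ I p
  π-I = ≡-mat (reduce-[] p∣N 1) (reduce-[] p∣N 0) (reduce-[] p∣N 0) (reduce-[] p∣N 1)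


Cancellable : ∀ {N} .{{_ : NonZero N}} → Fin N → Set
Cancellable x = ∀ {y z} → x ⊗ y ≡ x ⊗ z → y ≡ z

module _ {p : ℕ} (pp : Prime p) (n : ℕ) where
  private instance
    _ = prime⇒nonZero pp
    _ = ℕ.m^n≢0 p n
  open CommutativeRing (ℤ/ (p ^ n) ℤ) using (_*_; _-_; 0#; ring; -‿inverseʳ)
  open RingProperties ring using (x∙y⁻¹≈ε⇒x≈y; x[y-z]≈xy-xz)

  ∤⇒cancellable : ∀ {x : Fin (p ^ n)} → ¬ p ∣ toℕ x → Cancellable x
  ∤⇒cancellable {x} p∤x {y} {z} xy≡xz =
    x∙y⁻¹≈ε⇒x≈y y z (∣⇒≡[0] (y - z) (p^n∣c*x⇒p^n∣x n pp p∤x ([]≡[0]⇒∣ x[y-z]≡0)))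
    where
    x[y-z]≡0 : [ toℕ x ℕ.* toℕ (y - z) ] ≡ 0#
    x[y-z]≡0 = begin
      [ toℕ x ℕ.* toℕ (y - z) ] ≡⟨ ⊗≡mod x (y - z) ⟨
      x * (y - z)               ≡⟨ x[y-z]≈xy-xz x y z ⟩
      x * y - x * z             ≡⟨ cong (_- x * z) xy≡xz ⟩
      x * z - x * z             ≡⟨ -‿inverseʳ (x * z) ⟩
      0#                        ∎
      where open ≡-Reasoning

-- Upper triangular matrices intertwined by a matrix

module _ {N : ℕ} .{{_ : NonZero N}} where
  open CommutativeRing (ℤ/ N ℤ) using (_+_; _*_; 0#; +-identityˡ; +-identityʳ; zeroˡ; zeroʳ; *-comm)

  private
    0x+y≡y : ∀ x y → 0# * x + y ≡ y
    0x+y≡y x y = trans (cong (_+ y) (zeroˡ x)) (+-identityˡ y)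
    x+y0≡x : ∀ x y → x + y * 0# ≡ x
    x+y0≡x x y = trans (cong (x +_) (zeroʳ y)) (+-identityʳ x)

  module _ {g k m : Mat N} (cg-cancel : Cancellable (c g)) (ck≡0 : c k ≡ 0#) (cm≡0 : c m ≡ 0#) where
    open ≡-Reasoning

    intertwined-bottomRow : mul g k ≡ mul m g → c g * b k + d g * d k ≡ a k * d g
    intertwined-bottomRow gk≡mg = begin
      c g * b k + d g * d k  ≡⟨ cong d gk≡mg ⟩
      c m * b g + d m * d g  ≡⟨ cong (λ x → x * b g + d m * d g) cm≡0 ⟩
      0# * b g + d m * d g   ≡⟨ 0x+y≡y (b g) (d m * d g) ⟩
      d m * d g              ≡⟨ cong (_* d g) dm≡ak ⟩
      a k * d g              ∎
      where
      dm≡ak : d m ≡ a k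
      dm≡ak = cg-cancel (begin
        c g * d m              ≡⟨ *-comm (c g) (d m) ⟩
        d m * c g              ≡⟨ 0x+y≡y (a g) (d m * c g) ⟨
        0# * a g + d m * c g   ≡⟨ cong (λ x → x * a g + d m * c g) cm≡0 ⟨
        c m * a g + d m * c g  ≡⟨ cong c gk≡mg ⟨
        c g * a k + d g * c k  ≡⟨ cong (λ x → c g * a k + d g * x) ck≡0 ⟩
        c g * a k + d g * 0#   ≡⟨ x+y0≡x (c g * a k) (d g) ⟩
        c g * a k              ∎)

    intertwined-firstColumn : mul g m ≡ mul k g → a g * d k ≡ a k * a g + b k * c g
    intertwined-firstColumn gm≡kg = begin
      a g * d k              ≡⟨ cong (a g *_) am≡dk ⟨
      a g * a m              ≡⟨ x+y0≡x (a g * a m) (b g) ⟨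
      a g * a m + b g * 0#   ≡⟨ cong (λ x → a g * a m + b g * x) cm≡0 ⟨
      a g * a m + b g * c m  ≡⟨ cong a gm≡kg ⟩
      a k * a g + b k * c g  ∎
      where
      am≡dk : a m ≡ d k
      am≡dk = cg-cancel (begin
        c g * a m              ≡⟨ x+y0≡x (c g * a m) (d g) ⟨
        c g * a m + d g * 0#   ≡⟨ cong (λ x → c g * a m + d g * x) cm≡0 ⟨
        c g * a m + d g * c m  ≡⟨ cong c gm≡kg ⟩
        c k * a g + d k * c g  ≡⟨ cong (λ x → x * a g + d k * c g) ck≡0 ⟩
        0# * a g + d k * c g   ≡⟨ 0x+y≡y (a g) (d k * c g) ⟩
        d k * c g              ≡⟨ *-comm (d k) (c g) ⟩
        c g * d k              ∎)

-- The kernel of reduction modulo p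

kernel : ∀ {N} (p : ℕ) → Prime p → Subset₂ N → Subset₂ N
kernel p pp H k = H k ∧ (π p pp k == I p)
  where instance _ = prime⇒nonZero pp

module _ {p : ℕ} (pp : Prime p) {N : ℕ} .{{_ : NonZero N}} (p∣N : p ∣ N)
         {H : Subset₂ N} (H≤GL : IsSubgroupGL N H) where
  private
    instance _ = prime⇒nonZero pp
    π′ : Mat N → Mat p
    π′ = π p pp
    K : Subset₂ N
    K = kernel p pp H

  mul-closed : ∀ {g h} → T (H g) → T (H h) → T (H (mul g h))
  mul-closed = proj₁ (proj₂ (proj₂ H≤GL)) _ _

  inverse : ∀ {g} → T (H g) → Σ (Mat N) λ h → T (H h) × mul g h ≡ I N × mul h g ≡ I N
  inverse = proj₂ (proj₂ (proj₂ H≤GL)) _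

  ∈kernel⁺ : ∀ {k} → T (H k) → π′ k ≡ I p → T (K k)
  ∈kernel⁺ k∈H πk≡I = Equivalence.from T-∧ (k∈H , ≡⇒== πk≡I)

  ∈kernel⁻ : ∀ {k} → T (K k) → T (H k) × π′ k ≡ I p
  ∈kernel⁻ k∈K = let k∈H , πk==I = Equivalence.to T-∧ k∈K in k∈H , ==⇒≡ πk==I

  conjugate-∈kernel : ∀ {g h k} → T (H g) → T (H h) → mul g h ≡ I N → T (K k) → T (K (mul (mul g k) h))
  conjugate-∈kernel {g} {h} {k} g∈H h∈H gh≡I k∈K =
    ∈kernel⁺ (mul-closed (mul-closed g∈H k∈H) h∈H) (begin
      π′ (mul (mul g k) h)            ≡⟨ π-mul pp p∣N (mul g k) h ⟩
      mul (π′ (mul g k)) (π′ h)       ≡⟨ cong (λ X → mul X (π′ h)) (π-mul pp p∣N g k) ⟩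
      mul (mul (π′ g) (π′ k)) (π′ h)  ≡⟨ cong (λ X → mul (mul (π′ g) X) (π′ h)) πk≡I ⟩
      mul (mul (π′ g) (I p)) (π′ h)   ≡⟨ cong (λ X → mul X (π′ h)) (mul-identityʳ (π′ g)) ⟩
      mul (π′ g) (π′ h)               ≡⟨ π-mul pp p∣N g h ⟨
      π′ (mul g h)                    ≡⟨ cong π′ gh≡I ⟩
      π′ (I N)                        ≡⟨ π-I pp p∣N ⟩
      I p                             ∎)
    where
    open ≡-Reasoning
    k∈H = proj₁ (∈kernel⁻ k∈K)
    πk≡I = proj₂ (∈kernel⁻ k∈K)

  π∈image : ∀ {g} → T (H g) → T (image p pp H (π′ g))
  π∈image {g} g∈H = any⁺ _ (Any.map (λ { refl → Equivalence.from T-∧ (g∈H , ≡⇒== {A = π′ g} refl) }) (∈-allMats g))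

  card≤card-image*card-kernel : card H ≤ card (image p pp H) ℕ.* card K
  card≤card-image*card-kernel =
    fibres≤⇒length≤ π′ _≟ᴹ_ (elements (image p pp H)) (∈-elements⁺ ∘ π∈image ∘ ∈-elements⁻) fibre≤
    where
    fibre≤ : ∀ {r} → r ∈ elements H → length (fibre π′ _≟ᴹ_ (π′ r) (elements H)) ≤ card K
    fibre≤ {r} r∈H with inverse (∈-elements⁻ r∈H)
    ... | s , s∈H , rs≡I , sr≡I =
      injectiveOn⇒length≤ (mul s) (Unique.filter⁺ _ (elements-Unique H)) into (λ _ _ → mul-cancelˡ rs≡I)
      where
      into : ∀ {g} → g ∈ fibre π′ _≟ᴹ_ (π′ r) (elements H) → mul s g ∈ elements K
      into {g} g∈fibre with ∈-filter⁻ (λ x → π′ x ≟ᴹ π′ r) {xs = elements H} g∈fibre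
      ... | g∈H , πg≡πr = ∈-elements⁺ (∈kernel⁺ (mul-closed s∈H (∈-elements⁻ g∈H)) (begin
        π′ (mul s g)          ≡⟨ π-mul pp p∣N s g ⟩
        mul (π′ s) (π′ g)     ≡⟨ cong (mul (π′ s)) πg≡πr ⟩
        mul (π′ s) (π′ r)     ≡⟨ π-mul pp p∣N s r ⟨
        π′ (mul s r)          ≡⟨ cong π′ sr≡I ⟩
        π′ (I N)              ≡⟨ π-I pp p∣N ⟩
        I p                   ∎))
        where open ≡-Reasoning

-- Subgroups with 1-uppertriangular tendencies

module _ {p : ℕ} (pp : Prime p) {n : ℕ} (n≥1 : 1 ≤ n) {H : Subset₂ (p ^ n)}
         (H≤GL : IsSubgroupGLpn p n pp H) (tendencies : UpperTendencies p n 1 H) where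
  private
    instance
      _ = prime⇒nonZero pp
      _ = ℕ.m^n≢0 p n
    K : Subset₂ (p ^ n)
    K = kernel p pp H
    p∣p^n : p ∣ p ^ n
    p∣p^n = m∣m^n p n≥1

  open CommutativeRing (ℤ/ (p ^ n) ℤ) using (_+_; _*_; 0#; ring; *-comm; +-identityˡ; zeroʳ)
  open RingProperties ring using (+-cancelʳ)

  kernel⇒c≡0 : ∀ {k} → T (K k) → c k ≡ 0#
  kernel⇒c≡0 {k} k∈K with ∈kernel⁻ pp p∣p^n H≤GL k∈K
  ... | k∈H , πk≡I = ∣⇒≡[0] (c k) (tendencies k k∈H
      (subst (_∣ toℕ (c k)) (sym (ℕ.*-identityʳ p)) ([]≡[0]⇒∣ (cong c πk≡I))))

  private
    quotient< : (x : Fin (p ^ n)) → toℕ x / p < p ^ (n ∸ 1)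
    quotient< x = m<n*o⇒m/o<n (subst (toℕ x <_) (m^n≡m^[n∸1]*m p n≥1) (toℕ<n x))

    quotient-injective : ∀ {x y : Fin (p ^ n)} → toℕ x % p ≡ 1 % p → toℕ y % p ≡ 1 % p →
                         toℕ x / p ≡ toℕ y / p → x ≡ y
    quotient-injective x≡1 y≡1 = toℕ-injective ∘ %∧/⇒≡ p (trans x≡1 (sym y≡1))

  kernel-a-injective : ∀ {k k′} → T (K k) → T (K k′) → toℕ (a k) / p ≡ toℕ (a k′) / p → a k ≡ a k′
  kernel-a-injective k∈K k′∈K = quotient-injective (diagonal≡1 k∈K) (diagonal≡1 k′∈K)
    where diagonal≡1 = λ {k} k∈K → []≡[]⇒%≡% (cong a (proj₂ (∈kernel⁻ pp p∣p^n H≤GL {k} k∈K)))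

  kernel-d-injective : ∀ {k k′} → T (K k) → T (K k′) → toℕ (d k) / p ≡ toℕ (d k′) / p → d k ≡ d k′
  kernel-d-injective k∈K k′∈K = quotient-injective (diagonal≡1 k∈K) (diagonal≡1 k′∈K)
    where diagonal≡1 = λ {k} k∈K → []≡[]⇒%≡% (cong d (proj₂ (∈kernel⁻ pp p∣p^n H≤GL {k} k∈K)))

  module _ {t : Mat (p ^ n)} (t∈H : T (H t)) (p∤ct : ¬ p ∣ toℕ (c t)) where
    private
      t⁻¹ : Σ (Mat (p ^ n)) λ s → T (H s) × mul t s ≡ I (p ^ n) × mul s t ≡ I (p ^ n)
      t⁻¹ = inverse pp p∣p^n H≤GL t∈H
      s = proj₁ t⁻¹
      s∈H = proj₁ (proj₂ t⁻¹)
      ts≡I = proj₁ (proj₂ (proj₂ t⁻¹))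
      st≡I = proj₂ (proj₂ (proj₂ t⁻¹))
      ct-cancel : Cancellable (c t)
      ct-cancel = ∤⇒cancellable pp n p∤ct

    kernel-bottomRow : ∀ {k} → T (K k) → c t * b k + d t * d k ≡ a k * d t
    kernel-bottomRow {k} k∈K = intertwined-bottomRow ct-cancel (kernel⇒c≡0 k∈K)
      (kernel⇒c≡0 (conjugate-∈kernel pp p∣p^n H≤GL t∈H s∈H ts≡I k∈K))
      (sym (conjugate-intertwinesʳ k st≡I))

    kernel-firstColumn : ∀ {k} → T (K k) → a t * d k ≡ a k * a t + b k * c t
    kernel-firstColumn {k} k∈K = intertwined-firstColumn ct-cancel (kernel⇒c≡0 k∈K)
      (kernel⇒c≡0 (conjugate-∈kernel pp p∣p^n H≤GL s∈H t∈H st≡I k∈K))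
      (conjugate-intertwinesˡ k ts≡I)

    kernel-injective : ∀ {k k′} → T (K k) → T (K k′) → a k ≡ a k′ → d k ≡ d k′ → k ≡ k′
    kernel-injective {k} {k′} k∈K k′∈K ak≡ak′ dk≡dk′ =
      ≡-mat ak≡ak′ (ct-cancel (+-cancelʳ (d t * d k) (c t * b k) (c t * b k′) (begin
        c t * b k + d t * d k    ≡⟨ kernel-bottomRow k∈K ⟩
        a k * d t                ≡⟨ cong (_* d t) ak≡ak′ ⟩
        a k′ * d t               ≡⟨ kernel-bottomRow k′∈K ⟨
        c t * b k′ + d t * d k′  ≡⟨ cong (λ x → c t * b k′ + d t * x) dk≡dk′ ⟨
        c t * b k′ + d t * d k   ∎)))
        (trans (kernel⇒c≡0 k∈K) (sym (kernel⇒c≡0 k′∈K))) dk≡dk′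
      where open ≡-Reasoning

    card-kernel≤p^[n∸1]*p^[n∸1] : card K ≤ p ^ (n ∸ 1) ℕ.* p ^ (n ∸ 1)
    card-kernel≤p^[n∸1]*p^[n∸1] = begin
      card K                                       ≤⟨ injectiveOn⇒length≤ quotients (elements-Unique K) into inj ⟩
      length (cartesianProduct (upTo M) (upTo M))  ≡⟨ length-cartesianProduct (upTo M) (upTo M) ⟩
      length (upTo M) ℕ.* length (upTo M)          ≡⟨ cong₂ ℕ._*_ (length-upTo M) (length-upTo M) ⟩
      M ℕ.* M                                      ∎
      where
      open ℕ.≤-Reasoning
      M = p ^ (n ∸ 1)
      quotients : Mat (p ^ n) → ℕ × ℕ
      quotients k = toℕ (a k) / p , toℕ (d k) / p
      into : ∀ {k} → k ∈ elements K → quotients k ∈ cartesianProduct (upTo M) (upTo M)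
      into {k} _ = ∈-cartesianProduct⁺ (∈-upTo⁺ (quotient< (a k))) (∈-upTo⁺ (quotient< (d k)))
      inj : ∀ {k k′} → k ∈ elements K → k′ ∈ elements K → quotients k ≡ quotients k′ → k ≡ k′
      inj k∈K k′∈K q≡q′ = kernel-injective (∈-elements⁻ k∈K) (∈-elements⁻ k′∈K)
        (kernel-a-injective (∈-elements⁻ k∈K) (∈-elements⁻ k′∈K) (cong proj₁ q≡q′))
        (kernel-d-injective (∈-elements⁻ k∈K) (∈-elements⁻ k′∈K) (cong proj₂ q≡q′))

    module _ (p∤tr : ¬ p ∣ toℕ (tr t)) where

      kernel⇒scalar : ∀ {k} → T (K k) → d k ≡ a k × b k ≡ 0#
      kernel⇒scalar {k} k∈K = dk≡ak , bk≡0
        where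
        open ≡-Reasoning
        open SemiringSolver (CommutativeRing.commutativeSemiring (ℤ/ (p ^ n) ℤ))
        regroupˡ : ∀ at dt ct dk bk → (at + dt) * dk + ct * bk ≡ (ct * bk + dt * dk) + at * dk
        regroupˡ = solve 5 (λ at dt ct dk bk →
          (at :+ dt) :* dk :+ ct :* bk := (ct :* bk :+ dt :* dk) :+ at :* dk) refl
        regroupʳ : ∀ at dt ct ak bk → ak * dt + (ak * at + bk * ct) ≡ (at + dt) * ak + ct * bk
        regroupʳ = solve 5 (λ at dt ct ak bk →
          ak :* dt :+ (ak :* at :+ bk :* ct) := (at :+ dt) :* ak :+ ct :* bk) refl
        dk≡ak : d k ≡ a k
        dk≡ak = ∤⇒cancellable pp n p∤tr (+-cancelʳ (c t * b k) _ _ (begin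
          (a t + d t) * d k + c t * b k        ≡⟨ regroupˡ (a t) (d t) (c t) (d k) (b k) ⟩
          (c t * b k + d t * d k) + a t * d k  ≡⟨ cong₂ _+_ (kernel-bottomRow k∈K) (kernel-firstColumn k∈K) ⟩
          a k * d t + (a k * a t + b k * c t)  ≡⟨ regroupʳ (a t) (d t) (c t) (a k) (b k) ⟩
          (a t + d t) * a k + c t * b k        ∎))
        bk≡0 : b k ≡ 0#
        bk≡0 = ct-cancel (+-cancelʳ (d t * d k) _ _ (begin
          c t * b k + d t * d k  ≡⟨ kernel-bottomRow k∈K ⟩
          a k * d t              ≡⟨ cong (_* d t) dk≡ak ⟨
          d k * d t              ≡⟨ *-comm (d k) (d t) ⟩
          d t * d k              ≡⟨ +-identityˡ (d t * d k) ⟨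
          0# + d t * d k         ≡⟨ cong (_+ d t * d k) (zeroʳ (c t)) ⟨
          c t * 0# + d t * d k   ∎))

      card-kernel≤p^[n∸1] : card K ≤ p ^ (n ∸ 1)
      card-kernel≤p^[n∸1] = begin
        card K           ≤⟨ injectiveOn⇒length≤ quotient (elements-Unique K) into inj ⟩
        length (upTo M)  ≡⟨ length-upTo M ⟩
        M                ∎
        where
        open ℕ.≤-Reasoning
        M = p ^ (n ∸ 1)
        quotient : Mat (p ^ n) → ℕ
        quotient k = toℕ (a k) / p
        into : ∀ {k} → k ∈ elements K → quotient k ∈ upTo M
        into {k} _ = ∈-upTo⁺ (quotient< (a k))
        inj : ∀ {k k′} → k ∈ elements K → k′ ∈ elements K → quotient k ≡ quotient k′ → k ≡ k′
        inj k∈Ks k′∈Ks q≡q′ = kernel-injective k∈K k′∈K ak≡ak′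
            (trans (proj₁ (kernel⇒scalar k∈K)) (trans ak≡ak′ (sym (proj₁ (kernel⇒scalar k′∈K)))))
          where
          k∈K = ∈-elements⁻ k∈Ks
          k′∈K = ∈-elements⁻ k′∈Ks
          ak≡ak′ = kernel-a-injective k∈K k′∈K q≡q′

module _ {p n : ℕ} {H : Subset₂ (p ^ n)} where

  ¬upperTriangular⇒witness : ¬ UpperTriangularMod p n H → Σ (Mat (p ^ n)) λ t → T (H t) × ¬ p ∣ toℕ (c t)
  ¬upperTriangular⇒witness ¬ut with any? (λ g → T? (H g) ×-dec ¬? (p ∣? toℕ (c g))) (allMats (p ^ n))
  ... | yes found = satisfied found
  ... | no  none  = contradiction (λ g g∈H → decidable-stable (p ∣? toℕ (c g))
                      λ p∤cg → none (Any.map (λ { refl → g∈H , p∤cg }) (∈-allMats g))) ¬ut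

-- Imported only here: in the sections above, _*_ is also the multiplication of ℤ/Nℤ.
open import Data.Nat using (_*_)

corollary2p17 : (p n : ℕ) (pp : Prime p) → 2 ≤ n →
    (H : Subset₂ (p ^ n)) → IsSubgroupGLpn p n pp H →
    UpperTendencies p n 1 H →
    ¬ UpperTriangularMod p n H →
    (card H ≤ p ^ (2 * n ∸ 2) * card (image p pp H))
    × ((Σ (Mat (p ^ n)) λ g → T (H g) × ¬ (p ∣ toℕ (tr g)) × ¬ (p ∣ toℕ (c g)))
    → card H ≤ p ^ (n ∸ 1) * card (image p pp H))
corollary2p17 p n pp n≥2 H H≤GL tendencies ¬ut = bound₁ , bound₂
  where
  instance
    _ = prime⇒nonZero pp
    _ = ℕ.m^n≢0 p n
  n≥1 : 1 ≤ n
  n≥1 = ℕ.≤-trans (s≤s z≤n) n≥2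
  card≤_*card-image : ∀ {B} → card (kernel p pp H) ≤ B → card H ≤ B * card (image p pp H)
  card≤_*card-image {B} |K|≤B = begin
    card H                                      ≤⟨ card≤card-image*card-kernel pp (m∣m^n p n≥1) H≤GL ⟩
    card (image p pp H) * card (kernel p pp H)  ≤⟨ ℕ.*-monoʳ-≤ (card (image p pp H)) |K|≤B ⟩
    card (image p pp H) * B                     ≡⟨ ℕ.*-comm (card (image p pp H)) B ⟩
    B * card (image p pp H)                     ∎
    where open ℕ.≤-Reasoning
  bound₁ : card H ≤ p ^ (2 * n ∸ 2) * card (image p pp H)
  bound₁ with t , t∈H , p∤ct ← ¬upperTriangular⇒witness {n = n} ¬ut =
    subst (λ B → card H ≤ B * card (image p pp H)) (sym (m^[2n∸2]≡m^[n∸1]*m^[n∸1] p n≥1))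
      (card≤_*card-image (card-kernel≤p^[n∸1]*p^[n∸1] pp n≥1 H≤GL tendencies t∈H p∤ct))
  bound₂ : (Σ (Mat (p ^ n)) λ g → T (H g) × ¬ (p ∣ toℕ (tr g)) × ¬ (p ∣ toℕ (c g))) →
           card H ≤ p ^ (n ∸ 1) * card (image p pp H)
  bound₂ (t , t∈H , p∤tr , p∤ct) =
    card≤_*card-image (card-kernel≤p^[n∸1] pp n≥1 H≤GL tendencies t∈H p∤ct p∤tr)
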